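{- Let $m \geq 1$, let $k = 2m+4$, and let $G$ be a connected $SC_k$ graph. If $S$ is a minimal vertex separator of $G$ with $|S| \geq 3$, then $S$ is an independent set of $G$.
   Context: All graphs are finite, simple and undirected. A graph $G$ is an $SC_k$ graph if either $G$ has no cycle, or every induced cycle of $G$ has length exactly $k$. For non-adjacent vertices $u,v$, a set $R \subset V(G)$ is a $(u,v)$-vertex separator if $u$ and $v$ lie in different connected components of $G - R$; it is minimal if no proper subset of $R$ is a $(u,v)$-vertex separator. A minimal vertex separator of $G$ is a set that is a minimal $(u,v)$-vertex separator for some pair of non-adjacent vertices $u,v$. -}

module Defs where

open import Data.Nat using (ℕ; zero; suc; _≤_)
open import Data.Fin using (Fin; toℕ)
open import Data.Fin.Subset using (Subset; _∈_; _∉_; _⊂_; ⊥)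
open import Data.Product using (_×_; Σ; ∃; ∃-syntax)
open import Data.Sum using (_⊎_)
open import Relation.Nullary using (¬_; Dec)
open import Relation.Binary.PropositionalEquality using (_≡_; _≢_)
open import Function.Definitions using (Injective)
open import Function.Bundles using (_⇔_)

record Graph (n : ℕ) : Set₁ where
  field
    Adj     : Fin n → Fin n → Set
    Adj?    : ∀ u v → Dec (Adj u v)
    sym     : ∀ {u v} → Adj u v → Adj v u
    irrefl  : ∀ {u} → ¬ Adj u u
open Graph public

module _ {n : ℕ} (G : Graph n) where

  data Reach (R : Subset n) : Fin n → Fin n → Set where
    here : ∀ {u} → u ∉ R → Reach R u u
    step : ∀ {u w v} → u ∉ R → Adj G u w → Reach R w v → Reach R u v

  Connected : Set
  Connected = ∀ u v → Reach ⊥ u v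

  Separator : Subset n → Fin n → Fin n → Set
  Separator R u v = u ∉ R × v ∉ R × ¬ Reach R u v

  MinimalSeparator : Subset n → Fin n → Fin n → Set
  MinimalSeparator R u v =
    Separator R u v × (∀ R′ → R′ ⊂ R → ¬ Separator R′ u v)

  MinimalVertexSeparator : Subset n → Set
  MinimalVertexSeparator S =
    ∃[ u ] ∃[ v ] (u ≢ v × ¬ Adj G u v × MinimalSeparator S u v)

  Independent : Subset n → Set
  Independent S = ∀ {x y} → x ∈ S → y ∈ S → ¬ Adj G x y

CycAdj : (len : ℕ) → Fin len → Fin len → Set
CycAdj len i j =
  toℕ j ≡ suc (toℕ i) ⊎ toℕ i ≡ suc (toℕ j)
  ⊎ (toℕ i ≡ 0 × suc (toℕ j) ≡ len) ⊎ (toℕ j ≡ 0 × suc (toℕ i) ≡ len)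

module _ {n : ℕ} (G : Graph n) where

  IsCycle : (len : ℕ) → (Fin len → Fin n) → Set
  IsCycle len c = 3 ≤ len × Injective _≡_ _≡_ c
                  × (∀ i j → CycAdj len i j → Adj G (c i) (c j))

  IsInducedCycle : (len : ℕ) → (Fin len → Fin n) → Set
  IsInducedCycle len c = 3 ≤ len × Injective _≡_ _≡_ c
                  × (∀ i j → Adj G (c i) (c j) ⇔ CycAdj len i j)

  HasCycle : Set
  HasCycle = ∃[ len ] Σ (Fin len → Fin n) (IsCycle len)

  SC : ℕ → Set
  SC k = ¬ HasCycle ⊎ (∀ len c → IsInducedCycle len c → len ≡ k)

-- Let S be a minimal (u,v)-separator, U and W the components of u and v in G - S, and suppose
-- that x, y ∈ S are adjacent; pick a third vertex z ∈ S. By minimality every vertex of S has a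
-- neighbour in U and one in W, so any two vertices of S are joined by an induced path with
-- interior in U and by one with interior in W; for non-adjacent ends the two paths form an
-- induced cycle, of length |I| + |J| + 2 = k for interiors I and J. If z is adjacent to both x and
-- y, xyz is a triangle. If z is adjacent to x only, the first neighbour of x on the y–z path with
-- interior I closes an induced cycle of length at most |I| + 3, and likewise on the other path,
-- so 2k ≤ |I| + |J| + 6 = k + 4. If z is adjacent to neither, such a neighbour inside I would close
-- a cycle shorter than k, so x and y have no neighbours inside the paths; then the edge xy with a
-- y–z path through U and an x–z path through W is an induced cycle, as is the one with U and W
-- exchanged, and adding the lengths of these two and of the two original cycles gives
-- 2k + 2 = 2k.

module Submission where

open import Defs
open import Data.Nat using (ℕ; _≤_; _+_; _*_)
open import Data.Fin.Subset using (Subset; ∣_∣)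

open import Data.Empty using (⊥; ⊥-elim)
open import Data.Fin as Fin using (Fin; zero; suc; toℕ)
import Data.Fin.Properties as Fin
open import Data.Fin.Subset using (_∈_; _∉_; _⊆_; _-_; _∪_; ⁅_⁆; inside; outside)
open import Data.Fin.Subset.Properties
  using (_∈?_; x∈p⇒p-x⊂p; x∈p∧x≢y⇒x∈p-y; p─q⊆p; x∈p∪q⁺; x∈⁅x⁆; ∣⁅x⁆∣≡1; p⊆q⇒∣p∣≤∣q∣)
open import Data.List using (List; []; _∷_; _++_; [_]; length; lookup; reverse)
import Data.List.Properties as List
open import Data.List.Membership.Propositional.Properties using (∈-lookup)
open import Data.List.Relation.Unary.All as All using (All; []; _∷_)
open import Data.List.Relation.Unary.All.Properties using (++⁺; ++⁻ˡ; ++⁻ʳ; ¬Any⇒All¬)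
open import Data.List.Relation.Unary.Any as Any using (Any; here; there)
import Data.List.Relation.Unary.Any.Properties as Any
import Data.List.Relation.Unary.First as First
open import Data.List.Relation.Unary.First.Properties using (toView)
open import Data.Nat using (zero; suc; _<_; z≤n; s≤s)
import Data.Nat.Properties as ℕ
open import Data.Nat.Tactic.RingSolver using (solve-∀)
open import Data.Product using (∃-syntax; _×_; _,_; proj₁; proj₂)
open import Data.Sum as Sum using (_⊎_; inj₁; inj₂)
open import Data.Vec using () renaming ([] to []ᵛ; _∷_ to _∷ᵛ_)
open import Function.Base using (_∘_)
open import Function.Bundles using (mk⇔; Equivalence)
open import Relation.Binary.PropositionalEquality as ≡ using (_≡_; _≢_; refl; cong; cong₂; subst)
open import Relation.Nullary using (¬_; ¬?; Dec; yes; no)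
import Relation.Nullary.Decidable as Dec

module _ {A : Set} where

  private
    variable
      m s t x z : A
      L Y : List A

  ∷ʳ-++⁺ : ∀ {P : A → Set} X → All P (X ++ [ m ]) → All P Y → All P (X ++ m ∷ Y)
  ∷ʳ-++⁺ []      (pm ∷ []) pY = pm ∷ pY
  ∷ʳ-++⁺ (_ ∷ X) (px ∷ pX) pY = px ∷ ∷ʳ-++⁺ X pX pY

  All-reverse : ∀ {P : A → Set} → All P L → All P (reverse L)
  All-reverse ps = All.tabulate (λ x∈ → All.lookup ps (Any.reverse⁻ x∈))

  lookup-All : ∀ {P : A → Set} → All P L → ∀ i → P (lookup L i)
  lookup-All ps i = All.lookup ps (∈-lookup i)

  length-∷ʳ : ∀ (M : List A) → length (M ++ [ t ]) ≡ suc (length M)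
  length-∷ʳ {t} M = ≡.trans (List.length-++-sucʳ M t []) (cong (suc ∘ length) (List.++-identityʳ M))

  <-length-∷ʳ : ∀ {b} I → b < length (I ++ [ z ]) → b ≤ length I
  <-length-∷ʳ I b< = ℕ.≤-pred (subst (_ <_) (length-∷ʳ I) b<)

  lookup-∷ʳ : ∀ M (j : Fin (length (M ++ [ t ]))) →
              (∃[ j′ ] toℕ j′ ≡ toℕ j × lookup (M ++ [ t ]) j ≡ lookup M j′)
              ⊎ (toℕ j ≡ length M × lookup (M ++ [ t ]) j ≡ t)
  lookup-∷ʳ []      zero    = inj₂ (refl , refl)
  lookup-∷ʳ (_ ∷ M) zero    = inj₁ (zero , refl , refl)
  lookup-∷ʳ (_ ∷ M) (suc j) with lookup-∷ʳ M j
  ... | inj₁ (j′ , e₁ , e₂) = inj₁ (suc j′ , cong suc e₁ , e₂)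
  ... | inj₂ (e₁ , e₂)      = inj₂ (cong suc e₁ , e₂)

  data Last : List A → A → Set where
    last-[-] : Last [ t ] t
    last-∷   : Last L t → Last (x ∷ L) t

  last-tail : ∀ {P : A → Set} → Last (x ∷ L) t → Any P L → Last L t
  last-tail (last-∷ l) _ = l

  last-∷ʳ : Last (s ∷ L) t → (L ≡ [] × s ≡ t) ⊎ ∃[ I ] L ≡ I ++ [ t ]
  last-∷ʳ last-[-]                = inj₁ (refl , refl)
  last-∷ʳ (last-∷ {L = y ∷ L} l) with last-∷ʳ l
  ... | inj₁ (refl , refl) = inj₂ ([] , refl)
  ... | inj₂ (I , e)       = inj₂ (y ∷ I , cong (y ∷_) e)

Consecutive : ℕ → ℕ → Set
Consecutive i j = j ≡ suc i ⊎ i ≡ suc j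

CycAdj-sym : ∀ {len} {i j : Fin len} → CycAdj len i j → CycAdj len j i
CycAdj-sym (inj₁ e)                = inj₂ (inj₁ e)
CycAdj-sym (inj₂ (inj₁ e))         = inj₁ e
CycAdj-sym (inj₂ (inj₂ (inj₁ e)))  = inj₂ (inj₂ (inj₂ e))
CycAdj-sym (inj₂ (inj₂ (inj₂ e)))  = inj₂ (inj₂ (inj₁ e))

∣p∪q∣≤∣p∣+∣q∣ : ∀ {n} (p q : Subset n) → ∣ p ∪ q ∣ ≤ ∣ p ∣ + ∣ q ∣
∣p∪q∣≤∣p∣+∣q∣ []ᵛ            []ᵛ            = z≤n
∣p∪q∣≤∣p∣+∣q∣ (outside ∷ᵛ p) (outside ∷ᵛ q) = ∣p∪q∣≤∣p∣+∣q∣ p q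
∣p∪q∣≤∣p∣+∣q∣ (inside ∷ᵛ p)  (outside ∷ᵛ q) = s≤s (∣p∪q∣≤∣p∣+∣q∣ p q)
∣p∪q∣≤∣p∣+∣q∣ (outside ∷ᵛ p) (inside ∷ᵛ q)  =
  subst (suc ∣ p ∪ q ∣ ≤_) (≡.sym (ℕ.+-suc ∣ p ∣ ∣ q ∣)) (s≤s (∣p∪q∣≤∣p∣+∣q∣ p q))
∣p∪q∣≤∣p∣+∣q∣ (inside ∷ᵛ p)  (inside ∷ᵛ q)  =
  subst (suc ∣ p ∪ q ∣ ≤_) (≡.sym (ℕ.+-suc (suc ∣ p ∣) ∣ q ∣)) (s≤s (ℕ.m≤n⇒m≤1+n (∣p∪q∣≤∣p∣+∣q∣ p q)))

third-element : ∀ {n} (S : Subset n) x y → 3 ≤ ∣ S ∣ → ∃[ z ] z ∈ S × z ≢ x × z ≢ y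
third-element S x y 3≤∣S∣ with Fin.any? (λ z → z ∈? S Dec.×-dec ¬? (z Fin.≟ x) Dec.×-dec ¬? (z Fin.≟ y))
... | yes found = found
... | no none   = ⊥-elim (ℕ.<-irrefl refl (ℕ.≤-trans 3≤∣S∣ ∣S∣≤2))
  where
  S⊆⁅x⁆∪⁅y⁆ : S ⊆ ⁅ x ⁆ ∪ ⁅ y ⁆
  S⊆⁅x⁆∪⁅y⁆ {w} w∈S with w Fin.≟ x | w Fin.≟ y
  ... | yes refl | _        = x∈p∪q⁺ (inj₁ (x∈⁅x⁆ x))
  ... | no _     | yes refl = x∈p∪q⁺ (inj₂ (x∈⁅x⁆ y))
  ... | no w≢x   | no w≢y   = ⊥-elim (none (w , w∈S , w≢x , w≢y))
  ∣S∣≤2 : ∣ S ∣ ≤ 2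
  ∣S∣≤2 = begin
    ∣ S ∣                   ≤⟨ p⊆q⇒∣p∣≤∣q∣ S⊆⁅x⁆∪⁅y⁆ ⟩
    ∣ ⁅ x ⁆ ∪ ⁅ y ⁆ ∣        ≤⟨ ∣p∪q∣≤∣p∣+∣q∣ ⁅ x ⁆ ⁅ y ⁆ ⟩
    ∣ ⁅ x ⁆ ∣ + ∣ ⁅ y ⁆ ∣    ≡⟨ cong₂ _+_ (∣⁅x⁆∣≡1 x) (∣⁅x⁆∣≡1 y) ⟩
    2                       ∎
    where open ℕ.≤-Reasoning

module _ {n : ℕ} (G : Graph n) where

  private
    V : Set
    V = Fin n

    variable
      a b c h m o s t x y z : V
      R S : Subset n
      I J L M Y : List V

  infix 4 _~_ _≁_

  _~_ _≁_ : V → V → Set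
  x ~ y = Adj G x y
  x ≁ y = ¬ x ~ y

  ~-sym : x ~ y → y ~ x
  ~-sym = sym G

  ~⇒≢ : x ~ y → x ≢ y
  ~⇒≢ xy refl = irrefl G xy

  data InducedPath : List V → Set where
    []   : InducedPath []
    [-]  : InducedPath [ x ]
    cons : x ~ y → All (x ≢_) (y ∷ L) → All (x ≁_) L → InducedPath (y ∷ L) → InducedPath (x ∷ y ∷ L)

  Apart : List V → List V → Set
  Apart X Y = All (λ a → All (λ b → a ≢ b × a ≁ b) Y) X

  path-tail : InducedPath (x ∷ L) → InducedPath L
  path-tail [-]            = []
  path-tail (cons _ _ _ p) = p

  path-fresh : InducedPath (x ∷ L) → All (x ≢_) L
  path-fresh [-]            = []
  path-fresh (cons _ d _ _) = d

  path-++⁻ˡ : ∀ X → InducedPath (X ++ Y) → InducedPath X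
  path-++⁻ˡ []           _               = []
  path-++⁻ˡ (_ ∷ [])     _               = [-]
  path-++⁻ˡ (_ ∷ _ ∷ X) (cons a d na p) = cons a (++⁻ˡ (_ ∷ X) d) (++⁻ˡ X na) (path-++⁻ˡ (_ ∷ X) p)

  path-∷ʳ-fresh : ∀ X → InducedPath (X ++ [ t ]) → All (_≢ t) X
  path-∷ʳ-fresh []      _ = []
  path-∷ʳ-fresh (_ ∷ X) p with ++⁻ʳ X (path-fresh p)
  ... | d ∷ [] = d ∷ path-∷ʳ-fresh X (path-tail p)

  path-glue : ∀ X → InducedPath (X ++ [ m ]) → InducedPath (m ∷ Y) → Apart X Y → InducedPath (X ++ m ∷ Y)
  path-glue []           _               q _        = q
  path-glue (_ ∷ [])     (cons a d _ _)  q (c ∷ []) =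
    cons a (∷ʳ-++⁺ [] d (All.map proj₁ c)) (All.map proj₂ c) q
  path-glue (_ ∷ _ ∷ X) (cons a d na p) q (c ∷ cs) =
    cons a (∷ʳ-++⁺ (_ ∷ X) d (All.map proj₁ c)) (∷ʳ-++⁺ X na (All.map proj₂ c)) (path-glue (_ ∷ X) p q cs)

  path-reverse : InducedPath L → InducedPath (reverse L)
  path-reverse []                                 = []
  path-reverse [-]                                = [-]
  path-reverse (cons {x} {y} {L} a (_ ∷ d) na p) =
    subst InducedPath (≡.sym reverse-∷∷) (path-glue (reverse L) p′ (cons (~-sym a) (≡.≢-sym (~⇒≢ a) ∷ []) [] [-]) apart)
    where
    reverse-∷∷ : reverse (x ∷ y ∷ L) ≡ reverse L ++ y ∷ [ x ]
    reverse-∷∷ = ≡.trans (List.unfold-reverse x (y ∷ L))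
                   (≡.trans (cong (_++ [ x ]) (List.unfold-reverse y L)) (List.++-assoc (reverse L) [ y ] [ x ]))
    p′ : InducedPath (reverse L ++ [ y ])
    p′ = subst InducedPath (List.unfold-reverse y L) (path-reverse p)
    apart : Apart (reverse L) [ x ]
    apart = All-reverse (All.zipWith (λ (x≢b , x≁b) → (≡.≢-sym x≢b , x≁b ∘ ~-sym) ∷ []) (d , na))

  path-~⇒consecutive : InducedPath L → ∀ i j → lookup L i ~ lookup L j → Consecutive (toℕ i) (toℕ j)
  path-~⇒consecutive [-]             zero          zero          a = ⊥-elim (irrefl G a)
  path-~⇒consecutive (cons _ _ _ _)  zero          zero          a = ⊥-elim (irrefl G a)
  path-~⇒consecutive (cons _ _ _ _)  zero          (suc zero)    _ = inj₁ refl
  path-~⇒consecutive (cons _ _ na _) zero          (suc (suc j)) a = ⊥-elim (lookup-All na j a)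
  path-~⇒consecutive (cons _ _ _ _)  (suc zero)    zero          _ = inj₂ refl
  path-~⇒consecutive (cons _ _ na _) (suc (suc i)) zero          a = ⊥-elim (lookup-All na i (~-sym a))
  path-~⇒consecutive (cons _ _ _ p)  (suc i)       (suc j)       a =
    Sum.map (cong suc) (cong suc) (path-~⇒consecutive p i j a)

  path-consecutive⇒~ : InducedPath L → ∀ i j → Consecutive (toℕ i) (toℕ j) → lookup L i ~ lookup L j
  path-consecutive⇒~ (cons a _ _ _) zero       (suc zero) _ = a
  path-consecutive⇒~ (cons a _ _ _) (suc zero) zero       _ = ~-sym a
  path-consecutive⇒~ (cons _ _ _ p) (suc i)    (suc j)    c =
    path-consecutive⇒~ p i j (Sum.map ℕ.suc-injective ℕ.suc-injective c)
  path-consecutive⇒~ [-]            zero          zero          (inj₁ ())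
  path-consecutive⇒~ [-]            zero          zero          (inj₂ ())
  path-consecutive⇒~ (cons _ _ _ _) zero          zero          (inj₁ ())
  path-consecutive⇒~ (cons _ _ _ _) zero          zero          (inj₂ ())
  path-consecutive⇒~ (cons _ _ _ _) zero          (suc (suc _)) (inj₁ ())
  path-consecutive⇒~ (cons _ _ _ _) zero          (suc (suc _)) (inj₂ ())
  path-consecutive⇒~ (cons _ _ _ _) (suc (suc _)) zero          (inj₁ ())
  path-consecutive⇒~ (cons _ _ _ _) (suc (suc _)) zero          (inj₂ ())

  path-lookup-injective : InducedPath L → ∀ i j → lookup L i ≡ lookup L j → i ≡ j
  path-lookup-injective [-]            zero    zero    _ = refl
  path-lookup-injective (cons _ _ _ _) zero    zero    _ = refl
  path-lookup-injective (cons _ d _ _) zero    (suc j) e = ⊥-elim (lookup-All d j e)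
  path-lookup-injective (cons _ d _ _) (suc i) zero    e = ⊥-elim (lookup-All d i (≡.sym e))
  path-lookup-injective (cons _ _ _ p) (suc i) (suc j) e = cong suc (path-lookup-injective p i j e)

  path-close : InducedPath (h ∷ m ∷ M) → InducedPath (m ∷ M ++ [ t ]) → t ~ h → h ≢ t →
               IsInducedCycle G (length (h ∷ m ∷ M ++ [ t ])) (lookup (h ∷ m ∷ M ++ [ t ]))
  path-close {h} {m} {M} {t} hM Mt th h≢t = s≤s (s≤s (List.length-++-≤ʳ [ t ] {M})) , injective , λ i j → mk⇔ (to i j) (from i j)
    where
    P : List V
    P = m ∷ M ++ [ t ]

    len : ℕ
    len = suc (length P)

    ∣P∣ : length P ≡ suc (length (m ∷ M))
    ∣P∣ = length-∷ʳ (m ∷ M)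

    to-apex : ∀ j → h ~ lookup P j → CycAdj len zero (suc j)
    to-apex j a with lookup-∷ʳ (m ∷ M) j
    ... | inj₂ (e₁ , _) = inj₂ (inj₂ (inj₁ (refl , cong suc (≡.trans (cong suc e₁) (≡.sym ∣P∣)))))
    ... | inj₁ (j′ , e₁ , e₂) with path-~⇒consecutive hM zero (suc j′) (subst (h ~_) e₂ a)
    ...   | inj₁ e = inj₁ (cong suc (≡.trans (≡.sym e₁) (ℕ.suc-injective e)))

    from-apex : ∀ j → CycAdj len zero (suc j) → h ~ lookup P j
    from-apex j c with lookup-∷ʳ (m ∷ M) j
    ... | inj₂ (_ , e₂) = subst (h ~_) (≡.sym e₂) (~-sym th)
    from-apex j (inj₁ e) | inj₁ (j′ , e₁ , e₂) =
      subst (h ~_) (≡.sym e₂) (path-consecutive⇒~ hM zero (suc j′) (inj₁ (cong suc (≡.trans e₁ (ℕ.suc-injective e)))))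
    from-apex j (inj₂ (inj₂ (inj₁ (_ , e)))) | inj₁ (j′ , e₁ , _) =
      ⊥-elim (ℕ.<-irrefl (≡.trans e₁ (ℕ.suc-injective (≡.trans (ℕ.suc-injective e) ∣P∣))) (Fin.toℕ<n j′))
    from-apex j (inj₂ (inj₂ (inj₂ (() , _)))) | inj₁ _

    to : ∀ i j → lookup (h ∷ P) i ~ lookup (h ∷ P) j → CycAdj len i j
    to zero    zero    a = ⊥-elim (irrefl G a)
    to zero    (suc j) a = to-apex j a
    to (suc i) zero    a = CycAdj-sym (to-apex i (~-sym a))
    to (suc i) (suc j) a = Sum.map (cong suc) (inj₁ ∘ cong suc) (path-~⇒consecutive Mt i j a)

    from : ∀ i j → CycAdj len i j → lookup (h ∷ P) i ~ lookup (h ∷ P) j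
    from zero    (suc j) c = from-apex j c
    from (suc i) zero    c = ~-sym (from-apex i (CycAdj-sym c))
    from (suc i) (suc j) (inj₁ e)         = path-consecutive⇒~ Mt i j (inj₁ (ℕ.suc-injective e))
    from (suc i) (suc j) (inj₂ (inj₁ e))  = path-consecutive⇒~ Mt i j (inj₂ (ℕ.suc-injective e))
    from zero    zero    (inj₁ ())
    from zero    zero    (inj₂ (inj₁ ()))
    from zero    zero    (inj₂ (inj₂ (inj₁ (_ , ()))))
    from zero    zero    (inj₂ (inj₂ (inj₂ (_ , ()))))
    from (suc i) (suc j) (inj₂ (inj₂ (inj₁ (() , _))))
    from (suc i) (suc j) (inj₂ (inj₂ (inj₂ (() , _))))

    apex-fresh : ∀ j → h ≢ lookup P j
    apex-fresh j e with lookup-∷ʳ (m ∷ M) j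
    ... | inj₁ (j′ , _ , e₂) = lookup-All (path-fresh hM) j′ (≡.trans e e₂)
    ... | inj₂ (_ , e₂)      = h≢t (≡.trans e e₂)

    injective : ∀ {i j} → lookup (h ∷ P) i ≡ lookup (h ∷ P) j → i ≡ j
    injective {zero}  {zero}  _ = refl
    injective {zero}  {suc j} e = ⊥-elim (apex-fresh j e)
    injective {suc i} {zero}  e = ⊥-elim (apex-fresh i (≡.sym e))
    injective {suc i} {suc j} e = cong suc (path-lookup-injective Mt i j e)

  data Walk (Q : V → Set) : V → V → Set where
    stop : Q x → Walk Q x x
    move : Q x → x ~ y → Walk Q y t → Walk Q x t

  walk-∷ʳ : ∀ {Q} → Walk Q x y → y ~ t → Q t → Walk Q x t
  walk-∷ʳ (stop qx)      yt qt = move qx yt (stop qt)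
  walk-∷ʳ (move qx xw w) yt qt = move qx xw (walk-∷ʳ w yt qt)

  InducedPathIn : (V → Set) → V → V → Set
  InducedPathIn Q s t = ∃[ L ] InducedPath (s ∷ L) × Last (s ∷ L) t × All Q (s ∷ L)

  _~⁼_ : V → V → Set
  x ~⁼ y = x ~ y ⊎ x ≡ y

  _~⁼?_ : ∀ x y → Dec (x ~⁼ y)
  x ~⁼? y = Adj? G x y Dec.⊎-dec x Fin.≟ y

  -- x is joined to the last vertex of the path that it touches; everything before that vertex is dropped.
  prepend : ∀ {Q} → Q x → InducedPath L → Last L t → All Q L → Any (x ~⁼_) L → InducedPathIn Q x t
  prepend {x} {y ∷ L} qx p l qs touch with Any.any? (x ~⁼?_) L
  ... | yes touch′ = prepend qx (path-tail p) (last-tail l touch′) (All.tail qs) touch′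
  ... | no untouched with touch
  ...   | there touch′     = ⊥-elim (untouched touch′)
  ...   | here (inj₂ refl) = L , p , l , qs
  ...   | here (inj₁ xy)   =
    y ∷ L , cons xy (~⇒≢ xy ∷ All.map (_∘ inj₂) apart) (All.map (_∘ inj₁) apart) p , last-∷ l , qx ∷ qs
    where
    apart : All (λ w → ¬ x ~⁼ w) L
    apart = ¬Any⇒All¬ L untouched

  walk⇒inducedPath : ∀ {Q} → Walk Q x t → InducedPathIn Q x t
  walk⇒inducedPath (stop qx) = [] , [-] , last-[-] , qx ∷ []
  walk⇒inducedPath (move qx xy w) with walk⇒inducedPath w
  ... | L , p , l , qs = prepend qx p l qs (here (inj₁ xy))

  reach-trans : Reach G R a b → Reach G R b c → Reach G R a c
  reach-trans (here _)         r = r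
  reach-trans (step a∉R ab r′) r = step a∉R ab (reach-trans r′ r)

  reach-source∉ : Reach G R a b → a ∉ R
  reach-source∉ (here a∉R)     = a∉R
  reach-source∉ (step a∉R _ _) = a∉R

  reach-target∉ : Reach G R a b → b ∉ R
  reach-target∉ (here b∉R)   = b∉R
  reach-target∉ (step _ _ r) = reach-target∉ r

  reach-∷ʳ : Reach G R a b → b ~ c → c ∉ R → Reach G R a c
  reach-∷ʳ r bc c∉R = reach-trans r (step (reach-target∉ r) bc (here c∉R))

  reach-sym : Reach G R a b → Reach G R b a
  reach-sym (here a∉R)      = here a∉R
  reach-sym (step a∉R ab r) = reach-∷ʳ (reach-sym r) (~-sym ab) a∉R

  reach⇒walk : ∀ {Q} → (∀ {w} → Reach G R o w → Q w) → Reach G R o a → Reach G R a b → Walk Q a b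
  reach⇒walk f oa (here _)      = stop (f oa)
  reach⇒walk f oa (step _ ab r) = move (f oa) ab (reach⇒walk f (reach-∷ʳ oa ab (reach-source∉ r)) r)

  component-fresh : x ∈ R → Reach G R o a → x ≢ a
  component-fresh x∈R r refl = reach-target∉ r x∈R

  component-apart : ¬ Reach G R a b → All (Reach G R a) I → All (Reach G R b) J → Apart I J
  component-apart a↮b aI bJ = All.map (λ ax → All.map (λ by →
      (λ { refl → a↮b (reach-trans ax (reach-sym by)) }) ,
      (λ xy → a↮b (reach-trans (reach-∷ʳ ax xy (reach-target∉ by)) (reach-sym by)))) bJ) aI

  reach-exit : Reach G (S - s) a b → Reach G S o a → ¬ Reach G S o b → ∃[ c ] Reach G S o c × c ~ s
  reach-exit (here _) oa o↮b = ⊥-elim (o↮b oa)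
  reach-exit {S} {s} (step {w = w} _ aw r) oa o↮b with w ∈? S
  ... | no w∉S = reach-exit r (reach-∷ʳ oa aw w∉S) o↮b
  ... | yes w∈S with w Fin.≟ s
  ...   | yes refl = _ , oa , aw
  ...   | no w≢s   = ⊥-elim (reach-source∉ r (x∈p∧x≢y⇒x∈p-y w∈S w≢s))

  separator-sym : Separator G R a b → Separator G R b a
  separator-sym (a∉R , b∉R , a↮b) = b∉R , a∉R , a↮b ∘ reach-sym

  minimal-sym : MinimalSeparator G S a b → MinimalSeparator G S b a
  minimal-sym (sep , minimal) = separator-sym sep , λ R R⊂S → minimal R R⊂S ∘ separator-sym

  minimal-neighbour : MinimalSeparator G S a b → s ∈ S → ¬ ¬ (∃[ c ] Reach G S a c × c ~ s)
  minimal-neighbour {S} {a} {b} {s} ((a∉S , b∉S , a↮b) , minimal) s∈S no-neighbour =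
    minimal (S - s) (x∈p⇒p-x⊂p s∈S)
      (a∉S ∘ p─q⊆p S ⁅ s ⁆ , b∉S ∘ p─q⊆p S ⁅ s ⁆ , λ r → no-neighbour (reach-exit r (here a∉S) a↮b))

  PathThrough : (V → Set) → V → V → Set
  PathThrough C s t = ∃[ I ] All C I × InducedPath (s ∷ I ++ [ t ])

  minimal-path : MinimalSeparator G S a b → s ∈ S → t ∈ S → s ≢ t → ¬ ¬ PathThrough (Reach G S a) s t
  minimal-path {S} {a} {b} {s} {t} mS s∈S t∈S s≢t no-path =
    minimal-neighbour mS s∈S λ (c , ac , cs) →
    minimal-neighbour mS t∈S λ (d , ad , dt) →
    no-path (through (walk⇒inducedPath
      (move (inj₂ (inj₁ refl)) (~-sym cs)
        (walk-∷ʳ (reach⇒walk inj₁ ac (reach-trans (reach-sym ac) ad)) dt (inj₂ (inj₂ refl))))))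
    where
    Q : V → Set
    Q w = Reach G S a w ⊎ w ≡ s ⊎ w ≡ t

    interior : ∀ {w} → Q w × s ≢ w × w ≢ t → Reach G S a w
    interior (inj₁ aw , _)                 = aw
    interior (inj₂ (inj₁ refl) , s≢s , _)  = ⊥-elim (s≢s refl)
    interior (inj₂ (inj₂ refl) , _ , t≢t)  = ⊥-elim (t≢t refl)

    through : InducedPathIn Q s t → PathThrough (Reach G S a) s t
    through (L , p , l , _ ∷ qs) with last-∷ʳ l
    ... | inj₁ (_ , s≡t) = ⊥-elim (s≢t s≡t)
    ... | inj₂ (I , refl) =
      I , All.zipWith interior (++⁻ˡ I qs , All.zip (++⁻ˡ I (path-fresh p) , All.tail (path-∷ʳ-fresh (s ∷ I) p))) , p

  path-reverse-ends : InducedPath (s ∷ I ++ [ t ]) → InducedPath (t ∷ reverse I ++ [ s ])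
  path-reverse-ends {s} {I} {t} p = subst InducedPath reverse-ends (path-reverse p)
    where
    reverse-ends : reverse (s ∷ I ++ [ t ]) ≡ t ∷ reverse I ++ [ s ]
    reverse-ends = ≡.trans (List.reverse-++ (s ∷ I) [ t ]) (cong (t ∷_) (List.unfold-reverse s I))

  path-interior-nonempty : y ≁ z → InducedPath (y ∷ J ++ [ z ]) → 1 ≤ length J
  path-interior-nonempty {J = []}    y≁z (cons yz _ _ _) = ⊥-elim (y≁z yz)
  path-interior-nonempty {J = _ ∷ _} _   _               = s≤s z≤n

  module _ {k : ℕ} (sc : SC G k) where

    inducedCycle-length : ∀ {len c} → IsInducedCycle G len c → len ≡ k
    inducedCycle-length {len} {c} cycle@(3≤len , injective , adjacency) =
      Sum.[ (λ acyclic → ⊥-elim (acyclic (len , c , 3≤len , injective , λ i j → Equivalence.from (adjacency i j))))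
          , (λ uniform → uniform len c cycle) ] sc

    path-close-length : InducedPath (h ∷ m ∷ M) → InducedPath (m ∷ M ++ [ t ]) → t ~ h → h ≢ t → 3 + length M ≡ k
    path-close-length {M = M} hM Mt th h≢t =
      ≡.trans (cong (2 +_) (≡.sym (length-∷ʳ M))) (inducedCycle-length (path-close hM Mt th h≢t))

    chord-length : InducedPath (y ∷ L) → x ~ y → All (x ≢_) L → Any (x ~_) L → ∃[ b ] b < length L × 3 + b ≡ k
    chord-length {y} {L} {x} p xy x∉L chord with toView (First.refine (λ {w} _ → Dec.toSum (Adj? G x w)) (First.fromAny chord))
    ... | First._++_∷_ {B} {q} x≁B xq X =
      length B , ∣B∣<∣L∣ ,
      path-close-length (cons xy (~⇒≢ xy ∷ ++⁻ˡ B x∉L) x≁B (path-++⁻ˡ (y ∷ B) p)) (path-++⁻ˡ (y ∷ B ++ [ q ]) p′) (~-sym xq) (~⇒≢ xq)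
      where
      ∣B∣<∣L∣ : length B < length (B ++ q ∷ X)
      ∣B∣<∣L∣ = subst (length B <_) (≡.sym (List.length-++-sucʳ B q X)) (s≤s (List.length-++-≤ˡ B))
      p′ : InducedPath (y ∷ (B ++ [ q ]) ++ X)
      p′ = subst (InducedPath ∘ (y ∷_)) (≡.sym (List.++-assoc B [ q ] X)) p

    cycle-length : y ≁ t → InducedPath (y ∷ I ++ [ t ]) → InducedPath (y ∷ J ++ [ t ]) → Apart I J → 2 + (length I + length J) ≡ k
    cycle-length {I = []}    y≁t (cons yt _ _ _) _               _ = ⊥-elim (y≁t yt)
    cycle-length {J = []}    y≁t _               (cons yt _ _ _) _ = ⊥-elim (y≁t yt)
    cycle-length {y} {t} {i ∷ I} {r ∷ J} _ P (cons yr (_ ∷ y≢J) y≁J R) apart =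
      ≡.trans (cong (3 +_) (≡.sym ∣M∣)) (path-close-length yM Mr (~-sym yr) (~⇒≢ yr))
      where
      R⁻ : InducedPath (t ∷ reverse J ++ [ r ])
      R⁻ = path-reverse-ends R
      y-apart : All (λ b → y ≢ b × y ≁ b) (reverse J)
      y-apart = All-reverse (All.zip (++⁻ˡ J y≢J , ++⁻ˡ J y≁J))
      reverse-∷ : ∀ {Pr : V → Set} → All Pr (r ∷ J) → All Pr (reverse J ++ [ r ])
      reverse-∷ = subst (All _) (List.unfold-reverse r J) ∘ All-reverse
      yM : InducedPath (y ∷ i ∷ I ++ t ∷ reverse J)
      yM = path-glue (y ∷ i ∷ I) P (path-++⁻ˡ (t ∷ reverse J) R⁻) (y-apart ∷ All.map (All-reverse ∘ All.tail) apart)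
      Mr : InducedPath (i ∷ (I ++ t ∷ reverse J) ++ [ r ])
      Mr = subst (InducedPath ∘ (i ∷_)) (≡.sym (List.++-assoc I (t ∷ reverse J) [ r ]))
                 (path-glue (i ∷ I) (path-tail P) R⁻ (All.map reverse-∷ apart))
      ∣M∣ : length (I ++ t ∷ reverse J) ≡ length I + suc (length J)
      ∣M∣ = ≡.trans (List.length-++ I) (cong ((length I +_) ∘ suc) (List.length-reverse J))

    triangle-length : x ~ y → y ~ z → x ~ z → 3 ≡ k
    triangle-length xy yz xz =
      path-close-length (cons xy (~⇒≢ xy ∷ []) [] [-]) (cons yz (~⇒≢ yz ∷ []) [] [-]) (~-sym xz) (~⇒≢ xz)

    common-neighbour-bound : ¬ Reach G S a b → x ∈ S → x ~ y → x ~ z → y ≁ z →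
                             PathThrough (Reach G S a) y z → PathThrough (Reach G S b) y z → k ≤ 4
    common-neighbour-bound {S = S} {x = x} {z = z} a↮b x∈S xy xz y≁z (I , aI , P) (J , bJ , Q) =
      let b₁ , b₁< , e₁ = chord-length P xy (x∉ aI) (Any.++⁺ʳ I (here xz))
          b₂ , b₂< , e₂ = chord-length Q xy (x∉ bJ) (Any.++⁺ʳ J (here xz))
      in k≤4 e₁ e₂ (<-length-∷ʳ I b₁<) (<-length-∷ʳ J b₂<) (cycle-length y≁z P Q (component-apart a↮b aI bJ))
      where
      x∉ : ∀ {o L} → All (Reach G S o) L → All (x ≢_) (L ++ [ z ])
      x∉ oL = ++⁺ (All.map (component-fresh x∈S) oL) (~⇒≢ xz ∷ [])

      k≤4 : ∀ {b₁ b₂ i j} → 3 + b₁ ≡ k → 3 + b₂ ≡ k → b₁ ≤ i → b₂ ≤ j → 2 + (i + j) ≡ k → k ≤ 4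
      k≤4 {b₁} {b₂} {i} {j} e₁ e₂ b₁≤i b₂≤j e = ℕ.+-cancelˡ-≤ k k 4 (begin
        k + k                 ≡⟨ cong₂ _+_ (≡.sym e₁) (≡.sym e₂) ⟩
        (3 + b₁) + (3 + b₂)   ≤⟨ ℕ.+-mono-≤ (ℕ.+-monoʳ-≤ 3 b₁≤i) (ℕ.+-monoʳ-≤ 3 b₂≤j) ⟩
        (3 + i) + (3 + j)     ≡⟨ regroup i j ⟩
        (2 + (i + j)) + 4     ≡⟨ cong (_+ 4) e ⟩
        k + 4                 ∎)
        where
        open ℕ.≤-Reasoning
        regroup : ∀ i j → (3 + i) + (3 + j) ≡ (2 + (i + j)) + 4
        regroup = solve-∀

    no-chord : ¬ Reach G S a b → x ∈ S → x ~ y → y ≁ z →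
               All (Reach G S a) I → InducedPath (y ∷ I ++ [ z ]) →
               All (Reach G S b) J → InducedPath (y ∷ J ++ [ z ]) → All (x ≁_) I
    no-chord {y = y} {I = I} {J = J} a↮b x∈S xy y≁z aI P bJ Q = ¬Any⇒All¬ I λ chord →
      let c , c< , e = chord-length (path-++⁻ˡ (y ∷ I) P) xy (All.map (component-fresh x∈S) aI) chord
      in too-long e c< (path-interior-nonempty y≁z Q) (cycle-length y≁z P Q (component-apart a↮b aI bJ))
      where
      too-long : ∀ {c i j} → 3 + c ≡ k → c < i → 1 ≤ j → 2 + (i + j) ≡ k → ⊥
      too-long {c} {i} {j} e₁ c<i 1≤j e₂ = ℕ.<-irrefl (≡.trans e₁ (≡.sym e₂)) (begin-strict
        3 + c        ≤⟨ ℕ.+-monoʳ-≤ 2 c<i ⟩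
        2 + i        <⟨ ℕ.+-monoʳ-< 2 (ℕ.m<m+n i 1≤j) ⟩
        2 + (i + j)  ∎)
        where open ℕ.≤-Reasoning

    detour-length : ¬ Reach G S a b → x ∈ S → y ∈ S → x ~ y → x ≢ z → x ≁ z →
                    All (Reach G S a) I → InducedPath (y ∷ I ++ [ z ]) → All (x ≁_) I →
                    All (Reach G S b) J → InducedPath (x ∷ J ++ [ z ]) → All (y ≁_) J →
                    3 + (length I + length J) ≡ k
    detour-length a↮b x∈S y∈S xy x≢z x≁z aI P x≁I bJ Q y≁J =
      cycle-length x≁z
        (cons xy (~⇒≢ xy ∷ ++⁺ (All.map (component-fresh x∈S) aI) (x≢z ∷ [])) (++⁺ x≁I (x≁z ∷ [])) P) Q
        (All.zip (All.map (component-fresh y∈S) bJ , y≁J) ∷ component-apart a↮b aI bJ)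

    no-common-neighbour : ¬ Reach G S a b → x ∈ S → y ∈ S → x ~ y → x ≢ z → y ≢ z → x ≁ z → y ≁ z →
                          PathThrough (Reach G S a) y z → PathThrough (Reach G S b) y z →
                          PathThrough (Reach G S a) x z → PathThrough (Reach G S b) x z → ⊥
    no-common-neighbour a↮b x∈S y∈S xy x≢z y≢z x≁z y≁z (I₁ , aI₁ , P₁) (J₁ , bJ₁ , Q₁) (I₂ , aI₂ , P₂) (J₂ , bJ₂ , Q₂) =
      four-cycles {length I₁} {length I₂} {length J₁} {length J₂}
        (detour-length a↮b x∈S y∈S xy x≢z x≁z aI₁ P₁ x≁I₁ bJ₂ Q₂ y≁J₂)
        (detour-length a↮b y∈S x∈S (~-sym xy) y≢z y≁z aI₂ P₂ y≁I₂ bJ₁ Q₁ x≁J₁)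
        (cycle-length y≁z P₁ Q₁ (component-apart a↮b aI₁ bJ₁))
        (cycle-length x≁z P₂ Q₂ (component-apart a↮b aI₂ bJ₂))
      where
      b↮a = a↮b ∘ reach-sym
      x≁I₁ = no-chord a↮b x∈S xy y≁z aI₁ P₁ bJ₁ Q₁
      x≁J₁ = no-chord b↮a x∈S xy y≁z bJ₁ Q₁ aI₁ P₁
      y≁I₂ = no-chord a↮b y∈S (~-sym xy) x≁z aI₂ P₂ bJ₂ Q₂
      y≁J₂ = no-chord b↮a y∈S (~-sym xy) x≁z bJ₂ Q₂ aI₂ P₂

      four-cycles : ∀ {i₁ i₂ j₁ j₂} → 3 + (i₁ + j₂) ≡ k → 3 + (i₂ + j₁) ≡ k →
                    2 + (i₁ + j₁) ≡ k → 2 + (i₂ + j₂) ≡ k → ⊥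
      four-cycles {i₁} {i₂} {j₁} {j₂} e₁ e₂ e₃ e₄ = ℕ.m≢1+n+m (k + k) {1} (begin
        k + k                                      ≡⟨ cong₂ _+_ (≡.sym e₁) (≡.sym e₂) ⟩
        (3 + (i₁ + j₂)) + (3 + (i₂ + j₁))          ≡⟨ regroup i₁ i₂ j₁ j₂ ⟩
        2 + ((2 + (i₁ + j₁)) + (2 + (i₂ + j₂)))    ≡⟨ cong (2 +_) (cong₂ _+_ e₃ e₄) ⟩
        2 + (k + k)                                ∎)
        where
        open ≡.≡-Reasoning
        regroup : ∀ i₁ i₂ j₁ j₂ → (3 + (i₁ + j₂)) + (3 + (i₂ + j₁)) ≡ 2 + ((2 + (i₁ + j₁)) + (2 + (i₂ + j₂)))
        regroup = solve-∀

  minimalSeparator-independent : ∀ {k} → 5 ≤ k → SC G k → MinimalVertexSeparator G S → 3 ≤ ∣ S ∣ → Independent G S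
  minimalSeparator-independent {S} {k} 5≤k sc (a , b , _ , _ , mS@((_ , _ , a↮b) , _)) 3≤∣S∣ {x} {y} x∈S y∈S xy =
    let z , z∈S , z≢x , z≢y = third-element S x y 3≤∣S∣
    in by-cases z∈S (≡.≢-sym z≢x) (≡.≢-sym z≢y) (Adj? G x z) (Adj? G y z)
    where
    mS′ = minimal-sym mS

    k≰4 : ¬ k ≤ 4
    k≰4 k≤4 = ℕ.<-irrefl refl (ℕ.≤-trans 5≤k k≤4)

    by-cases : z ∈ S → x ≢ z → y ≢ z → Dec (x ~ z) → Dec (y ~ z) → ⊥
    by-cases _ _ _ (yes xz) (yes yz) = k≰4 (subst (_≤ 4) (triangle-length sc xy yz xz) (ℕ.n≤1+n 3))
    by-cases z∈S _ y≢z (yes xz) (no y≁z) =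
      minimal-path mS  y∈S z∈S y≢z λ P →
      minimal-path mS′ y∈S z∈S y≢z λ Q →
      k≰4 (common-neighbour-bound sc a↮b x∈S xy xz y≁z P Q)
    by-cases z∈S x≢z _ (no x≁z) (yes yz) =
      minimal-path mS  x∈S z∈S x≢z λ P →
      minimal-path mS′ x∈S z∈S x≢z λ Q →
      k≰4 (common-neighbour-bound sc a↮b y∈S (~-sym xy) yz x≁z P Q)
    by-cases z∈S x≢z y≢z (no x≁z) (no y≁z) =
      minimal-path mS  y∈S z∈S y≢z λ Py →
      minimal-path mS′ y∈S z∈S y≢z λ Qy →
      minimal-path mS  x∈S z∈S x≢z λ Px →
      minimal-path mS′ x∈S z∈S x≢z λ Qx →
      no-common-neighbour sc a↮b x∈S y∈S xy x≢z y≢z x≁z y≁z Py Qy Px Qx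

lemma3 : (m : ℕ) → 1 ≤ m → (n : ℕ) → (G : Graph n) → Connected G → SC G (2 * m + 4)
       → (S : Subset n) → MinimalVertexSeparator G S → 3 ≤ ∣ S ∣ → Independent G S
lemma3 m 1≤m n G _ sc S =
  minimalSeparator-independent G (ℕ.≤-trans (ℕ.n≤1+n 5) (ℕ.+-monoˡ-≤ 4 (ℕ.*-monoʳ-≤ 2 1≤m))) sc
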